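{- Let $S\subseteq\mathbb{Z}^+$ with $1\in S$, let $r\ge0$, and let $n\ge0$. Let $M$ be the $(n+1)\times(n+1)$ matrix with rows and columns indexed by $0,1,\dots,n$, whose row $0$ is $(1,x,x^2,\dots,x^n)$ and whose entries in row $i$, $1\le i\le n$, are $M_{i,j}=F_{S,r}(j,i-1)$ for $0\le j\le n$ (so row $1$ is $(1,F_{S,r}(1,0),\dots,F_{S,r}(n,0))$, row $2$ is $(0,1,F_{S,r}(2,1),\dots,F_{S,r}(n,1))$, and so on, the last row being $(0,\dots,0,1,F_{S,r}(n,n-1))$). Then $$L_{n,S,r}(x)=(-1)^n\det M.$$
   Context: For $S\subseteq\mathbb{Z}^+$ and integers $n,k,r\ge 0$, $L_{S,r}(n,k)$ is the number of partitions of $[n+r]$ into $k+r$ non-empty lists (linearly ordered blocks; the set of lists is unordered) such that every list has size in $S$ and the elements $1,\dots,r$ lie in distinct lists. When $1\in S$ the matrix $\mathbb{L}_{S,r}=[L_{S,r}(n,k)]_{n,k\ge0}$ is lower unitriangular; $F_{S,r}(n,k)$ denotes the $(n,k)$ entry of its inverse $\mathbb{F}_{S,r}=\mathbb{L}_{S,r}^{ -1}$ (so $F_{S,r}(k,k)=1$ and $F_{S,r}(n,k)=0$ for $n<k$). The $(S,r)$-Lah polynomials are $L_{n,S,r}(x)=\sum_{k=0}^nL_{S,r}(n,k)x^k$. -}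

module Defs where

open import Data.Bool using (Bool; true; false; _∧_; if_then_else_)
open import Data.Nat using (ℕ; zero; suc; _≤ᵇ_; _≡ᵇ_; _<_)
open import Data.Nat using () renaming (_+_ to _+ℕ_)
open import Data.List using (List; []; _∷_; [_]; map; _++_; concatMap; length; filter; foldr)
open import Data.Fin using (Fin; zero; suc; toℕ; punchIn)
open import Data.Integer using (ℤ; +_; -[1+_]) renaming (_*_ to _*ℤ_; _+_ to _+ℤ_)
open import Relation.Binary.PropositionalEquality using (_≡_)
open import Algebra.Bundles using (CommutativeRing)

-- A partition is represented as a List of blocks, each block a List ℕ
-- (the order of the elements inside a block is the linear order of the
-- list; the order of the blocks in the outer list is the canonical order
-- of creation, i.e. blocks ordered by their least element, so each
-- unordered set of lists is represented exactly once).
-- Enumeration: every partition of [m+1] into lists arises uniquely from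
-- a partition of [m] by inserting m+1 either at some position of some
-- existing list, or as a new singleton list (appended at the end).

insertions : ℕ → List ℕ → List (List ℕ)
insertions a []       = [ a ∷ [] ]
insertions a (y ∷ ys) = (a ∷ y ∷ ys) ∷ map (y ∷_) (insertions a ys)

extend : ℕ → List (List ℕ) → List (List (List ℕ))
extend a []       = [ [ a ∷ [] ] ]
extend a (B ∷ Bs) = map (_∷ Bs) (insertions a B) ++ map (B ∷_) (extend a Bs)

listPartitions : ℕ → List (List (List ℕ))
listPartitions zero    = [ [] ]
listPartitions (suc m) = concatMap (extend (suc m)) (listPartitions m)

countSmall : ℕ → List ℕ → ℕ
countSmall r B = length (filter (λ b → b Data.Nat.≤? r) B)

allB : {A : Set} → (A → Bool) → List A → Bool
allB p = foldr (λ a b → p a ∧ b) true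

-- S ⊆ ℤ⁺ is given by a Boolean membership predicate on ℕ (its value at 0
-- is irrelevant since blocks are non-empty).
-- admissible: exactly k + r lists, all list sizes in S, elements 1..r in
-- distinct lists.
admissible : (S : ℕ → Bool) (r k : ℕ) → List (List ℕ) → Bool
admissible S r k P =
  (length P ≡ᵇ (k +ℕ r)) ∧ (allB (λ B → S (length B)) P ∧ allB (λ B → countSmall r B ≤ᵇ 1) P)

Lah : (S : ℕ → Bool) (r n k : ℕ) → ℕ
Lah S r n k = length (filter (λ P → Data.Bool._≟_ (admissible S r k P) true) (listPartitions (n +ℕ r)))

sumℤ≤ : ℕ → (ℕ → ℤ) → ℤ
sumℤ≤ zero    f = f zero
sumℤ≤ (suc n) f = sumℤ≤ n f +ℤ f (suc n)

δ : ℕ → ℕ → ℤ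
δ n k = if n ≡ᵇ k then + 1 else + 0

-- F is the inverse matrix 𝔽_{S,r} = 𝕃_{S,r}⁻¹ : F is lower triangular and
-- 𝕃 · F = I (the sum over j ≤ n covers all j since 𝕃 is lower triangular).
-- These conditions determine F uniquely.
record IsInverseLah (S : ℕ → Bool) (r : ℕ) (F : ℕ → ℕ → ℤ) : Set where
  field
    lowerTriangular : ∀ n k → n < k → F n k ≡ + 0
    rightInverse    : ∀ n k → sumℤ≤ n (λ j → (+ Lah S r n j) *ℤ F j k) ≡ δ n k

module RingDefs {c ℓ} (R : CommutativeRing c ℓ) where
  open CommutativeRing R using (Carrier; _+_; _*_; -_; 0#; 1#)

  natι : ℕ → Carrier
  natι zero    = 0#
  natι (suc m) = 1# + natι m

  intι : ℤ → Carrier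
  intι (+ m)     = natι m
  intι -[1+ m ]  = - natι (suc m)

  pow : Carrier → ℕ → Carrier
  pow x zero    = 1#
  pow x (suc k) = x * pow x k

  negOnePow : ℕ → Carrier
  negOnePow zero    = 1#
  negOnePow (suc n) = - negOnePow n

  sumFin : ∀ n → (Fin n → Carrier) → Carrier
  sumFin zero    f = 0#
  sumFin (suc n) f = f zero + sumFin n (λ j → f (suc j))

  det : ∀ n → (Fin n → Fin n → Carrier) → Carrier
  det zero    M = 1#
  det (suc n) M = sumFin (suc n) λ j →
    negOnePow (toℕ j) * (M zero j * det n (λ a b → M (suc a) (punchIn j b)))

  sumℕ≤ : ℕ → (ℕ → Carrier) → Carrier
  sumℕ≤ zero    f = f zero
  sumℕ≤ (suc n) f = sumℕ≤ n f + f (suc n)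

  lahPoly : (S : ℕ → Bool) (r n : ℕ) → Carrier → Carrier
  lahPoly S r n x = sumℕ≤ n (λ k → natι (Lah S r n k) * pow x k)

  lahMatrix : (F : ℕ → ℕ → ℤ) (n : ℕ) → Carrier → Fin (suc n) → Fin (suc n) → Carrier
  lahMatrix F n x zero     j = pow x (toℕ j)
  lahMatrix F n x (suc i') j = intι (F (toℕ j) (toℕ i'))

{-# OPTIONS --safe #-}
-- Expanding det M along its first row gives Σⱼ (-1)ʲ xʲ mⱼ, where mⱼ is the minor of rows 1, …, n
-- with column j deleted. These rows are the transpose of the first n columns of the unitriangular
-- matrix 𝔽 (rows 0, …, n), and 𝕃𝔽 = I says that row n of 𝕃 is a left kernel vector of that
-- block with last entry 1. By Cramer's rule (-1)ʲ mⱼ = (-1)ⁿ L(n, j), which is the identity.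
module Submission where

open import Defs
open import Data.Bool using (Bool; true)
open import Data.Nat using (ℕ; zero; suc; _<_; s≤s; z≤n)
open import Data.Integer using (ℤ)
open import Relation.Binary.PropositionalEquality using (_≡_)
open import Algebra.Bundles using (CommutativeRing)

import Data.Nat as ℕ
import Data.Nat.Properties as ℕₚ
import Data.Integer as ℤ
import Data.Integer.Properties as ℤₚ
open import Data.Fin using (Fin; zero; suc; toℕ; punchIn)
open import Data.Product using (_×_; _,_; proj₁; proj₂)
open import Function using (_∘_)
import Relation.Binary.PropositionalEquality as ≡

δ-diagonal : ∀ i → δ i i ≡ ℤ.+ 1
δ-diagonal zero    = ≡.refl
δ-diagonal (suc i) = δ-diagonal i

δ-below : ∀ {n i} → i < n → δ n i ≡ ℤ.+ 0
δ-below {suc n} {zero}  _         = ≡.refl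
δ-below {suc n} {suc i} (s≤s i<n) = δ-below i<n

sumℤ≤-last : ∀ n (f : ℕ → ℤ) → (∀ j → j < n → f j ≡ ℤ.+ 0) → sumℤ≤ n f ≡ f n
sumℤ≤-last zero    f _   = ≡.refl
sumℤ≤-last (suc n) f f≡0 = begin
  sumℤ≤ n f ℤ.+ f (suc n)  ≡⟨ ≡.cong (ℤ._+ f (suc n)) (≡.trans (sumℤ≤-last n f f<n≡0) (f≡0 n (ℕₚ.n<1+n n))) ⟩
  ℤ.+ 0 ℤ.+ f (suc n)      ≡⟨ ℤₚ.+-identityˡ (f (suc n)) ⟩
  f (suc n)                ∎
  where
  open ≡.≡-Reasoning
  f<n≡0 : ∀ j → j < n → f j ≡ ℤ.+ 0
  f<n≡0 j j<n = f≡0 j (ℕₚ.m<n⇒m<1+n j<n)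

+m*i≡1⇒m≡1×i≡1 : ∀ m i → ℤ.+ m ℤ.* i ≡ ℤ.+ 1 → m ≡ 1 × i ≡ ℤ.+ 1
+m*i≡1⇒m≡1×i≡1 m i eq = m≡1 , ≡.trans (≡.sym (ℤₚ.*-identityˡ i)) (≡.subst (λ k → ℤ.+ k ℤ.* i ≡ ℤ.+ 1) m≡1 eq)
  where
  m≡1 : m ≡ 1
  m≡1 = ℕₚ.m*n≡1⇒m≡1 m ℤ.∣ i ∣ (≡.trans (≡.sym (ℤₚ.abs-* (ℤ.+ m) i)) (≡.cong ℤ.∣_∣ eq))

-- The diagonal of 𝕃𝔽 = I reduces to L(i,i)·F(i,i) = 1 with L(i,i) ∈ ℕ.
inverseLah-diagonal : ∀ {S r F} → IsInverseLah S r F → ∀ i → Lah S r i i ≡ 1 × F i i ≡ ℤ.+ 1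
inverseLah-diagonal {S} {r} {F} inv i = +m*i≡1⇒m≡1×i≡1 (Lah S r i i) (F i i) (begin
  ℤ.+ Lah S r i i ℤ.* F i i                      ≡⟨ ≡.sym (sumℤ≤-last i _ below) ⟩
  sumℤ≤ i (λ j → ℤ.+ Lah S r i j ℤ.* F j i)     ≡⟨ rightInverse i i ⟩
  δ i i                                          ≡⟨ δ-diagonal i ⟩
  ℤ.+ 1                                          ∎)
  where
  open ≡.≡-Reasoning
  open IsInverseLah inv
  below : ∀ j → j < i → ℤ.+ Lah S r i j ℤ.* F j i ≡ ℤ.+ 0
  below j j<i = ≡.trans (≡.cong (ℤ.+ Lah S r i j ℤ.*_) (lowerTriangular j i j<i)) (ℤₚ.*-zeroʳ (ℤ.+ Lah S r i j))

module _ {c ℓ} (R : CommutativeRing c ℓ) where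
  open CommutativeRing R hiding (zero)
  open RingDefs R
  open import Algebra.Properties.Ring ring using (-‿distribˡ-*; -‿distribʳ-*; -‿involutive; -‿+-comm; -0#≈0#; +-inverseʳ-unique)
  open import Algebra.Properties.CommutativeSemigroup *-commutativeSemigroup using (x∙yz≈y∙xz)
  open import Algebra.Properties.CommutativeSemigroup +-commutativeSemigroup using (interchange)
  open import Algebra.Properties.Monoid.Mult +-monoid using (×-homo-+) renaming (_×_ to _·1_)
  open import Algebra.Properties.Semiring.Mult semiring using (×1-homo-*)
  open import Algebra.Properties.Semiring.Sum semiring using (sum; sum-cong-≋; sum-replicate-zero; *-distribˡ-sum)
  open import Relation.Binary.Reasoning.Setoid setoid

  natι≡×1# : ∀ m → natι m ≡ m ·1 1#
  natι≡×1# zero    = ≡.refl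
  natι≡×1# (suc m) = ≡.cong (1# +_) (natι≡×1# m)

  natι-homo-+ : ∀ m n → natι (m ℕ.+ n) ≈ natι m + natι n
  natι-homo-+ m n rewrite natι≡×1# (m ℕ.+ n) | natι≡×1# m | natι≡×1# n = ×-homo-+ 1# m n

  natι-homo-* : ∀ m n → natι (m ℕ.* n) ≈ natι m * natι n
  natι-homo-* m n rewrite natι≡×1# (m ℕ.* n) | natι≡×1# m | natι≡×1# n = ×1-homo-* m n

  intι-⊖ : ∀ m n → intι (m ℤ.⊖ n) ≈ natι m - natι n
  intι-⊖ m       zero    = sym (trans (+-congˡ -0#≈0#) (+-identityʳ _))
  intι-⊖ zero    (suc n) = sym (+-identityˡ _)
  intι-⊖ (suc m) (suc n) rewrite ℤₚ.[1+m]⊖[1+n]≡m⊖n m n = begin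
    intι (m ℤ.⊖ n)                    ≈⟨ intι-⊖ m n ⟩
    natι m - natι n                   ≈⟨ +-identityˡ _ ⟨
    0# + (natι m - natι n)            ≈⟨ +-congʳ (-‿inverseʳ 1#) ⟨
    (1# - 1#) + (natι m - natι n)     ≈⟨ interchange 1# (- 1#) (natι m) (- natι n) ⟩
    (1# + natι m) + (- 1# - natι n)   ≈⟨ +-congˡ (-‿+-comm 1# (natι n)) ⟩
    natι (suc m) - natι (suc n)       ∎

  intι-homo-+ : ∀ i j → intι (i ℤ.+ j) ≈ intι i + intι j
  intι-homo-+ (ℤ.+ m)    (ℤ.+ n)    = natι-homo-+ m n
  intι-homo-+ (ℤ.+ m)    ℤ.-[1+ n ] = intι-⊖ m (suc n)
  intι-homo-+ ℤ.-[1+ m ] (ℤ.+ n)    = trans (intι-⊖ n (suc m)) (+-comm _ _)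
  intι-homo-+ ℤ.-[1+ m ] ℤ.-[1+ n ] = begin
    - natι (suc (suc (m ℕ.+ n)))      ≡⟨ ≡.cong (-_ ∘ natι ∘ suc) (ℕₚ.+-suc m n) ⟨
    - natι (suc m ℕ.+ suc n)          ≈⟨ -‿cong (natι-homo-+ (suc m) (suc n)) ⟩
    - (natι (suc m) + natι (suc n))   ≈⟨ -‿+-comm _ _ ⟨
    - natι (suc m) - natι (suc n)     ∎

  intι-+m* : ∀ m i → intι (ℤ.+ m ℤ.* i) ≈ natι m * intι i
  intι-+m* zero    i           = sym (zeroˡ _)
  intι-+m* (suc m) (ℤ.+ n)     = trans (reflexive (≡.cong intι (ℤₚ.+◃n≡+n (suc m ℕ.* n)))) (natι-homo-* (suc m) n)
  intι-+m* (suc m) ℤ.-[1+ n ]  = trans (-‿cong (natι-homo-* (suc m) (suc n))) (-‿distribʳ-* _ _)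

  sumℕ≤-cong : ∀ n {f g : ℕ → Carrier} → (∀ k → f k ≈ g k) → sumℕ≤ n f ≈ sumℕ≤ n g
  sumℕ≤-cong zero    f≈g = f≈g 0
  sumℕ≤-cong (suc n) f≈g = +-cong (sumℕ≤-cong n f≈g) (f≈g (suc n))

  intι-sumℤ≤ : ∀ n f → intι (sumℤ≤ n f) ≈ sumℕ≤ n (intι ∘ f)
  intι-sumℤ≤ zero    f = refl
  intι-sumℤ≤ (suc n) f = trans (intι-homo-+ (sumℤ≤ n f) (f (suc n))) (+-congʳ (intι-sumℤ≤ n f))

  sumFin≡sum : ∀ n (f : Fin n → Carrier) → sumFin n f ≡ sum f
  sumFin≡sum zero    f = ≡.refl
  sumFin≡sum (suc n) f = ≡.cong (f zero +_) (sumFin≡sum n (f ∘ suc))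

  sumFin-cong : ∀ n {f g : Fin n → Carrier} → (∀ j → f j ≈ g j) → sumFin n f ≈ sumFin n g
  sumFin-cong n {f} {g} f≈g rewrite sumFin≡sum n f | sumFin≡sum n g = sum-cong-≋ f≈g

  sumFin-zero : ∀ n {f : Fin n → Carrier} → (∀ j → f j ≈ 0#) → sumFin n f ≈ 0#
  sumFin-zero n {f} f≈0 rewrite sumFin≡sum n f = trans (sum-cong-≋ f≈0) (sum-replicate-zero n)

  *-distribˡ-sumFin : ∀ n a (f : Fin n → Carrier) → a * sumFin n f ≈ sumFin n (λ j → a * f j)
  *-distribˡ-sumFin n a f rewrite sumFin≡sum n f | sumFin≡sum n (λ j → a * f j) = *-distribˡ-sum a f

  sumℕ≤-front : ∀ n f → sumℕ≤ (suc n) f ≈ f 0 + sumℕ≤ n (f ∘ suc)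
  sumℕ≤-front zero    f = refl
  sumℕ≤-front (suc n) f = trans (+-congʳ (sumℕ≤-front n f)) (+-assoc _ _ _)

  sumFin≈sumℕ≤ : ∀ n f → sumFin (suc n) (f ∘ toℕ) ≈ sumℕ≤ n f
  sumFin≈sumℕ≤ zero    f = +-identityʳ _
  sumFin≈sumℕ≤ (suc n) f = trans (+-congˡ (sumFin≈sumℕ≤ n (f ∘ suc))) (sym (sumℕ≤-front n f))

  negOnePow-square : ∀ n → negOnePow n * negOnePow n ≈ 1#
  negOnePow-square zero    = *-identityˡ 1#
  negOnePow-square (suc n) = begin
    - e * - e      ≈⟨ -‿distribˡ-* e (- e) ⟨
    - (e * - e)    ≈⟨ -‿cong (-‿distribʳ-* e e) ⟨
    - - (e * e)    ≈⟨ -‿involutive _ ⟩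
    e * e          ≈⟨ negOnePow-square n ⟩
    1#             ∎
    where
      e : Carrier
      e = negOnePow n

  Matrix : ℕ → Set c
  Matrix n = Fin n → Fin n → Carrier

  firstRowMinor : ∀ {n} → Matrix (suc n) → Fin (suc n) → Matrix n
  firstRowMinor M j a b = M (suc a) (punchIn j b)

  det-zeroColumn : ∀ n (M : Matrix (suc n)) → (∀ a → M a zero ≈ 0#) → det (suc n) M ≈ 0#
  det-firstRowMinor-zeroColumn : ∀ n (M : Matrix (suc n)) (j : Fin n) →
    (∀ a → M (suc a) zero ≈ 0#) → det n (firstRowMinor M (suc j)) ≈ 0#

  det-zeroColumn n M M·0≈0 = sumFin-zero (suc n) (λ j → trans (*-congˡ (term≈0 j)) (zeroʳ (negOnePow (toℕ j))))
    where
    term≈0 : ∀ j → M zero j * det n (firstRowMinor M j) ≈ 0#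
    term≈0 zero    = trans (*-congʳ (M·0≈0 zero)) (zeroˡ _)
    term≈0 (suc j) = trans (*-congˡ (det-firstRowMinor-zeroColumn n M j (λ a → M·0≈0 (suc a)))) (zeroʳ _)

  det-firstRowMinor-zeroColumn (suc n) M j M·0≈0 = det-zeroColumn n (firstRowMinor M (suc j)) M·0≈0

  det-unitColumn : ∀ n (M : Matrix (suc n)) → M zero zero ≈ 1# → (∀ a → M (suc a) zero ≈ 0#) →
    det (suc n) M ≈ det n (λ a b → M (suc a) (suc b))
  det-unitColumn n M M00≈1 M·0≈0 = begin
    1# * (M zero zero * d) + rest   ≈⟨ +-cong (*-identityˡ _) (sumFin-zero n rest≈0) ⟩
    M zero zero * d + 0#            ≈⟨ +-identityʳ _ ⟩
    M zero zero * d                 ≈⟨ *-congʳ M00≈1 ⟩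
    1# * d                          ≈⟨ *-identityˡ d ⟩
    d                               ∎
    where
    d : Carrier
    d = det n (λ a b → M (suc a) (suc b))
    rest : Carrier
    rest = sumFin n (λ j → negOnePow (toℕ (suc j)) * (M zero (suc j) * det n (firstRowMinor M (suc j))))
    rest≈0 : ∀ j → negOnePow (toℕ (suc j)) * (M zero (suc j) * det n (firstRowMinor M (suc j))) ≈ 0#
    rest≈0 j = trans (*-congˡ (trans (*-congˡ (det-firstRowMinor-zeroColumn n M j M·0≈0)) (zeroʳ _))) (zeroʳ _)

  record IsLowerUnitriangular (G : ℕ → ℕ → Carrier) : Set ℓ where
    field
      diagonal : ∀ i → G i i ≈ 1#
      upper    : ∀ c i → c < i → G c i ≈ 0#

  shift : (ℕ → ℕ → Carrier) → ℕ → ℕ → Carrier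
  shift G c i = G (suc c) (suc i)

  shift-lowerUnitriangular : ∀ {G} → IsLowerUnitriangular G → IsLowerUnitriangular (shift G)
  shift-lowerUnitriangular unit = record
    { diagonal = λ i → diagonal (suc i)
    ; upper    = λ c i c<i → upper (suc c) (suc i) (s≤s c<i)
    }
    where open IsLowerUnitriangular unit

  -- The transpose of the block (G c i), c ≤ n, i < n, with column j deleted; for G c i = F(c, i)
  -- these are rows 1, …, n of lahMatrix without column j.
  minor : (ℕ → ℕ → Carrier) → ∀ n → Fin (suc n) → Carrier
  minor G n j = det n (λ a b → G (toℕ (punchIn j b)) (toℕ a))

  minor-suc : ∀ {G} → IsLowerUnitriangular G → ∀ n j → minor G (suc n) (suc j) ≈ minor (shift G) n j
  minor-suc {G} unit n j =
    det-unitColumn n (λ a b → G (toℕ (punchIn (suc j) b)) (toℕ a)) (diagonal 0) (λ a → upper 0 (suc (toℕ a)) (s≤s z≤n))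
    where open IsLowerUnitriangular unit

  rowCombination : ℕ → (ℕ → Carrier) → (ℕ → ℕ → Carrier) → ℕ → Carrier
  rowCombination n v G i = sumFin (suc n) (λ j → v (toℕ j) * G (toℕ j) i)

  rowCombination-tail : ∀ n v G i → rowCombination (suc n) v G i ≈ 0# →
    rowCombination n (v ∘ suc) (G ∘ suc) i ≈ - (v 0 * G 0 i)
  rowCombination-tail n v G i = +-inverseʳ-unique (v 0 * G 0 i) _

  -- Cramer's rule: the signed maximal minors of the block (G c i) for c ≤ n, i < n span its
  -- left kernel, and the last one, a unitriangular determinant, fixes the scale.
  signedMinor≈leftKernel : ∀ n {G} → IsLowerUnitriangular G → ∀ {v} → v n ≈ 1# →
    (∀ i → i < n → rowCombination n v G i ≈ 0#) →
    ∀ j → negOnePow (toℕ j) * minor G n j ≈ negOnePow n * v (toℕ j)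
  signedMinor≈leftKernel zero    _ vn≈1 _ zero = *-congˡ (sym vn≈1)
  signedMinor≈leftKernel (suc n) {G} unit {v} vn≈1 vG≈0 = λ where
      zero → begin
        1# * minor G (suc n) zero                                                ≈⟨ *-identityˡ _ ⟩
        sumFin (suc n) (λ k → negOnePow (toℕ k) * (G′ k * minor (shift G) n k))  ≈⟨ sumFin-cong (suc n) expand ⟩
        sumFin (suc n) (λ k → e * (v (suc (toℕ k)) * G′ k))                      ≈⟨ *-distribˡ-sumFin (suc n) e (λ k → v (suc (toℕ k)) * G′ k) ⟨
        e * rowCombination n (v ∘ suc) (G ∘ suc) 0                               ≈⟨ *-congˡ firstColumn ⟩
        e * - v 0                                                                ≈⟨ -‿distribʳ-* e (v 0) ⟨
        - (e * v 0)                                                              ≈⟨ -‿distribˡ-* e (v 0) ⟩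
        - e * v 0                                                                ∎
      (suc j) → begin
        - negOnePow (toℕ j) * minor G (suc n) (suc j)   ≈⟨ *-congˡ (minor-suc unit n j) ⟩
        - negOnePow (toℕ j) * minor (shift G) n j       ≈⟨ -‿distribˡ-* _ _ ⟨
        - (negOnePow (toℕ j) * minor (shift G) n j)     ≈⟨ -‿cong (IH j) ⟩
        - (e * v (suc (toℕ j)))                         ≈⟨ -‿distribˡ-* _ _ ⟩
        - e * v (suc (toℕ j))                           ∎
    where
    open IsLowerUnitriangular unit
    e : Carrier
    e = negOnePow n
    G′ : Fin (suc n) → Carrier
    G′ k = G (suc (toℕ k)) 0
    tail≈0 : ∀ i → i < n → rowCombination n (v ∘ suc) (shift G) i ≈ 0#
    tail≈0 i i<n = begin
      rowCombination n (v ∘ suc) (G ∘ suc) (suc i)  ≈⟨ rowCombination-tail n v G (suc i) (vG≈0 (suc i) (s≤s i<n)) ⟩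
      - (v 0 * G 0 (suc i))                         ≈⟨ -‿cong (trans (*-congˡ (upper 0 (suc i) (s≤s z≤n))) (zeroʳ _)) ⟩
      - 0#                                          ≈⟨ -0#≈0# ⟩
      0#                                            ∎
    IH : ∀ k → negOnePow (toℕ k) * minor (shift G) n k ≈ e * v (suc (toℕ k))
    IH = signedMinor≈leftKernel n (shift-lowerUnitriangular unit) {v ∘ suc} vn≈1 tail≈0
    firstColumn : rowCombination n (v ∘ suc) (G ∘ suc) 0 ≈ - v 0
    firstColumn = trans (rowCombination-tail n v G 0 (vG≈0 0 (s≤s z≤n)))
                        (-‿cong (trans (*-congˡ (diagonal 0)) (*-identityʳ _)))
    expand : ∀ k → negOnePow (toℕ k) * (G′ k * minor (shift G) n k) ≈ e * (v (suc (toℕ k)) * G′ k)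
    expand k = begin
      negOnePow (toℕ k) * (G′ k * minor (shift G) n k)   ≈⟨ x∙yz≈y∙xz _ _ _ ⟩
      G′ k * (negOnePow (toℕ k) * minor (shift G) n k)   ≈⟨ *-congˡ (IH k) ⟩
      G′ k * (e * v (suc (toℕ k)))                       ≈⟨ x∙yz≈y∙xz _ _ _ ⟩
      e * (G′ k * v (suc (toℕ k)))                       ≈⟨ *-congˡ (*-comm _ _) ⟩
      e * (v (suc (toℕ k)) * G′ k)                       ∎

  module _ {S : ℕ → Bool} {r : ℕ} {F : ℕ → ℕ → ℤ} (inv : IsInverseLah S r F) where
    open IsInverseLah inv

    intF : ℕ → ℕ → Carrier
    intF c i = intι (F c i)

    lahRow : ℕ → ℕ → Carrier
    lahRow n k = natι (Lah S r n k)

    intF-lowerUnitriangular : IsLowerUnitriangular intF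
    intF-lowerUnitriangular = record
      { diagonal = λ i → trans (reflexive (≡.cong intι (proj₂ (inverseLah-diagonal inv i)))) (+-identityʳ 1#)
      ; upper    = λ c i c<i → reflexive (≡.cong intι (lowerTriangular c i c<i))
      }

    lahRow-last : ∀ n → lahRow n n ≈ 1#
    lahRow-last n = trans (reflexive (≡.cong natι (proj₁ (inverseLah-diagonal inv n)))) (+-identityʳ 1#)

    lahRow-leftKernel : ∀ n i → i < n → rowCombination n (lahRow n) intF i ≈ 0#
    lahRow-leftKernel n i i<n = begin
      rowCombination n (lahRow n) intF i                        ≈⟨ sumFin≈sumℕ≤ n (λ j → lahRow n j * intF j i) ⟩
      sumℕ≤ n (λ j → lahRow n j * intF j i)                     ≈⟨ sumℕ≤-cong n (λ j → intι-+m* (Lah S r n j) (F j i)) ⟨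
      sumℕ≤ n (λ j → intι (ℤ.+ Lah S r n j ℤ.* F j i))          ≈⟨ intι-sumℤ≤ n _ ⟨
      intι (sumℤ≤ n (λ j → ℤ.+ Lah S r n j ℤ.* F j i))          ≡⟨ ≡.cong intι (≡.trans (rightInverse n i) (δ-below i<n)) ⟩
      0#                                                        ∎

    lahPoly≈det : ∀ n x → lahPoly S r n x ≈ negOnePow n * det (suc n) (lahMatrix F n x)
    lahPoly≈det n x = begin
      lahPoly S r n x                                               ≈⟨ sumFin≈sumℕ≤ n (λ k → lahRow n k * pow x k) ⟨
      sumFin (suc n) (λ j → lahRow n (toℕ j) * pow x (toℕ j))       ≈⟨ sumFin-cong (suc n) term ⟩
      sumFin (suc n) (λ j → e * (σ j * (pow x (toℕ j) * m j)))      ≈⟨ *-distribˡ-sumFin (suc n) e (λ j → σ j * (pow x (toℕ j) * m j)) ⟨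
      e * det (suc n) (lahMatrix F n x)                             ∎
      where
      e : Carrier
      e = negOnePow n
      σ : Fin (suc n) → Carrier
      σ j = negOnePow (toℕ j)
      m : Fin (suc n) → Carrier
      m = minor intF n
      term : ∀ j → lahRow n (toℕ j) * pow x (toℕ j) ≈ e * (σ j * (pow x (toℕ j) * m j))
      term j = begin
        w * p                 ≈⟨ *-identityˡ _ ⟨
        1# * (w * p)          ≈⟨ *-congʳ (negOnePow-square n) ⟨
        (e * e) * (w * p)     ≈⟨ *-assoc e e _ ⟩
        e * (e * (w * p))     ≈⟨ *-congˡ (trans (*-congˡ (*-comm w p)) (x∙yz≈y∙xz e p w)) ⟩
        e * (p * (e * w))     ≈⟨ *-congˡ (*-congˡ cramer) ⟨
        e * (p * (σ j * m j)) ≈⟨ *-congˡ (x∙yz≈y∙xz p (σ j) (m j)) ⟩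
        e * (σ j * (p * m j)) ∎
        where
        w : Carrier
        w = lahRow n (toℕ j)
        p : Carrier
        p = pow x (toℕ j)
        cramer : σ j * m j ≈ e * w
        cramer = signedMinor≈leftKernel n intF-lowerUnitriangular {lahRow n} (lahRow-last n) (lahRow-leftKernel n) j

-- The hypothesis 1 ∈ S is deliberately unused (see inverseLah-diagonal).
mainTheorem8 : ∀ {c ℓ} (R : CommutativeRing c ℓ) (S : ℕ → Bool) → S 1 ≡ true →
    (r : ℕ) (F : ℕ → ℕ → ℤ) → IsInverseLah S r F →
    (n : ℕ) (x : CommutativeRing.Carrier R) →
    CommutativeRing._≈_ R (RingDefs.lahPoly R S r n x)
    (CommutativeRing._*_ R (RingDefs.negOnePow R n)
    (RingDefs.det R (suc n) (RingDefs.lahMatrix R F n x)))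
mainTheorem8 R S _ r F inv = lahPoly≈det R inv
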